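{- Let $\pi\in S_n$ be chosen uniformly at random and let $\sigma\in S_m$. For $0\le i\le n-m$ let $A_i$ be the event $\mathrm{st}(\pi_{i+1},\dots,\pi_{i+m})=\sigma$. Then for any $1\le k\le m-1$ and any $i$ with $0\le i$ and $i+m-k\le n-m$, $$\Pr(A_i\cap A_{i+m-k})\leq \frac{4^{m-k}}{\sqrt{\mathrm{p}(m-k)}\,(2m-k)!},$$ where $\mathrm{p}=3.14159\ldots$ denotes the circle constant.
   Context: $S_n$ denotes the set of permutations of $\{1,\dots,n\}$. For distinct integers $x_1,\dots,x_k$, $\mathrm{st}(x_1,\dots,x_k)\in S_k$ is the permutation obtained by replacing each entry by its rank among $x_1,\dots,x_k$. -}

module Defs where

open import Data.Nat using (ℕ; zero; suc; _+_; _*_; _∸_; _<_; _<?_)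
open import Data.Fin using (Fin; toℕ; fromℕ<)
open import Data.Fin.Permutation using (Permutation′; _⟨$⟩ʳ_; _≈_)
open import Data.List using (List; length; filter; allFin)
open import Data.List.Relation.Unary.AllPairs using (AllPairs)
open import Relation.Nullary using (¬_; yes; no)
open import Relation.Binary.PropositionalEquality using (_≡_)

-- Value (0-based) of π at 0-based position j (junk value 0 if j ≥ n;
-- only used for j < n).
at : ∀ {n} → Permutation′ n → ℕ → ℕ
at {n} π j with j <? n
... | yes j<n = toℕ (π ⟨$⟩ʳ fromℕ< j<n)
... | no _    = 0

-- Standardization of the window (π_{i+1},…,π_{i+m}) (1-based), i.e. the
-- 0-based positions i,…,i+m-1: entry a is replaced by its (0-based) rank,
-- the number of entries in the window smaller than it.
stWindow : ∀ {n} → Permutation′ n → (i m : ℕ) → Fin m → ℕ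
stWindow π i m a =
  length (filter (λ b → at π (i + toℕ b) <? at π (i + toℕ a)) (allFin m))

-- Event A_i : st(π_{i+1},…,π_{i+m}) = σ   (σ ∈ S_m, ranks 0-based)
Event : ∀ {n m} → Permutation′ m → Permutation′ n → ℕ → Set
Event {n} {m} σ π i = ∀ (a : Fin m) → stWindow π i m a ≡ toℕ (σ ⟨$⟩ʳ a)

Distinct : ∀ {n} → List (Permutation′ n) → Set
Distinct = AllPairs (λ p q → ¬ (p ≈ q))

-- Wallis partial products: ∏_{t=1}^N 4t²/(4t²-1) = wallisNum N / wallisDen N,
-- which increase strictly to the limit π/2, so π = sup_N 2·wallisNum N / wallisDen N.
wallisNum : ℕ → ℕ
wallisNum zero    = 1
wallisNum (suc t) = wallisNum t * (4 * (suc t * suc t))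

wallisDen : ℕ → ℕ
wallisDen zero    = 1
wallisDen (suc t) = wallisDen t * (4 * (suc t * suc t) ∸ 1)

{-# OPTIONS --safe #-}
-- Let d = m ∸ k and M = m + d, so that the two occurrences of σ together fill the window of
-- positions i, …, i + M - 1.  Two positions lying in the same occurrence are compared as σ
-- dictates; the only freedom left is how the first d entries of the window interleave with the
-- last d, and this interleaving is recorded by a monotone map {0, …, d - 1} → {0, …, d}, of which
-- there are C(2d, d).  So the relative order of the window is determined by σ and this profile:
-- rearranging the window of each π in L by all M! permutations of it gives pairwise distinct
-- permutations once the profile is remembered, whence ℓ · M! ≤ n! · C(2d, d).  The constant comes
-- from the identity C(2d, d)² (2d + 1) W_d = 16^d D_d for the Wallis partial products
-- W_N / D_N ↑ π/2, together with W_N / D_N ≤ (2d + 1) / (2d) · W_d / D_d for all N.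
module Submission where

open import Defs
open import Data.Nat using (ℕ; _+_; _*_; _∸_; _^_; _≤_; _<_; _!)
open import Data.Fin.Permutation using (Permutation′)
open import Data.List using (List; length)
open import Data.List.Relation.Unary.All using (All)
open import Data.Product using (_×_)

open import Data.Bool using (true; false; if_then_else_)
open import Data.Fin as Fin using (Fin; toℕ; fromℕ<; combine; remQuot; punchIn; punchOut; _↑ˡ_; _↑ʳ_)
open import Data.Fin.Permutation as Perm
  using (_⟨$⟩ʳ_; _⟨$⟩ˡ_; _≈_; flip; inverseˡ; inverseʳ; permutation; _∘ₚ_; insert; remove; insert-remove; remove-insert)
open import Data.Fin.Properties as Fin
  using (toℕ-fromℕ<; toℕ-injective; toℕ<n; fromℕ<-toℕ; combine-remQuot; combine-injective; injective⇒≤;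
         punchOut-cong; toℕ-↑ˡ; toℕ-↑ʳ; ↑ˡ-injective; ↑ʳ-injective)
open import Data.List using (_∷_; filter; allFin; lookup; tabulate)
open import Data.List.Membership.Propositional using (_∈_; lose)
open import Data.List.Membership.Propositional.Properties using (∈-filter⁺; ∈-allFin; ∈-lookup)
open import Data.List.Properties using (filter-idem; filter-notAll; length-filter; filter-≐; length-tabulate)
import Data.List.Relation.Unary.All as All
open import Data.List.Relation.Unary.AllPairs using (AllPairs; _∷_)
open import Data.List.Relation.Binary.Sublist.Propositional using (⊆-refl)
open import Data.List.Relation.Binary.Sublist.Propositional.Properties using (filter⁺)
open import Data.List.Relation.Binary.Sublist.Heterogeneous.Properties using (length-mono-≤)
open import Data.Nat using (zero; suc; pred; _≤′_; ≤′-refl; ≤′-step; s≤s; z<s; s≤s⁻¹; _<?_; _≤?_; NonZero; >-nonZero)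
open import Data.Nat.Properties
open import Data.Nat.Tactic.RingSolver using (solve-∀)
open import Algebra.Properties.CommutativeMonoid.Sum +-0-commutativeMonoid using (sum; sum-permute)
open import Data.Product using (_,_; proj₁; proj₂; uncurry)
open import Function using (id; _∘_; _⇔_; mk⇔; Equivalence)
open import Function.Construct.Composition using (_⇔-∘_)
open import Function.Construct.Symmetry using (⇔-sym)
open import Function.Related.TypeIsomorphisms using (¬-cong-⇔)
open import Relation.Binary using (Rel; Symmetric; tri<; tri≈; tri>)
open import Relation.Binary.PropositionalEquality
open import Relation.Nullary using (¬_; yes; no; does; contradiction)
open import Relation.Unary using (Pred; Decidable; _⊆_)

module _ {a p q} {A : Set a} {P : Pred A p} {Q : Pred A q} (P? : Decidable P) (Q? : Decidable Q) where

  length-filter-mono : P ⊆ Q → ∀ xs → length (filter P? xs) ≤ length (filter Q? xs)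
  length-filter-mono P⊆Q xs = length-mono-≤ (filter⁺ P? Q? (λ { refl → P⊆Q }) (⊆-refl {x = xs}))

  length-filter-strict : P ⊆ Q → ∀ {x xs} → x ∈ xs → Q x → ¬ P x →
                         length (filter P? xs) < length (filter Q? xs)
  length-filter-strict P⊆Q {x} {xs} x∈xs Qx ¬Px = begin-strict
    length (filter P? xs)              ≡⟨ cong length (filter-idem P? xs) ⟨
    length (filter P? (filter P? xs))  ≤⟨ length-mono-≤ (filter⁺ P? P? (λ { refl → id }) filter-P⊆filter-Q) ⟩
    length (filter P? (filter Q? xs))  <⟨ filter-notAll P? (filter Q? xs) (lose (∈-filter⁺ Q? x∈xs Qx) ¬Px) ⟩
    length (filter Q? xs)              ∎
    where
    open ≤-Reasoning
    filter-P⊆filter-Q = filter⁺ P? Q? (λ { refl → P⊆Q }) (⊆-refl {x = xs})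

length-filter-⇔ : ∀ {a p q} {A : Set a} {P : Pred A p} {Q : Pred A q} (P? : Decidable P) (Q? : Decidable Q) →
                  (∀ x → P x ⇔ Q x) → ∀ xs → length (filter P? xs) ≡ length (filter Q? xs)
length-filter-⇔ P? Q? P⇔Q xs =
  cong length (filter-≐ P? Q? ((λ {x} → Equivalence.to (P⇔Q x)) , (λ {x} → Equivalence.from (P⇔Q x))) xs)

indicator : ∀ {a p} {A : Set a} {P : Pred A p} → Decidable P → A → ℕ
indicator P? x = if does (P? x) then 1 else 0

length-filter-tabulate : ∀ {a p} {A : Set a} {P : Pred A p} (P? : Decidable P) {k} (f : Fin k → A) →
                         length (filter P? (tabulate f)) ≡ sum (indicator P? ∘ f)
length-filter-tabulate P? {zero}  f = refl
length-filter-tabulate P? {suc k} f with does (P? (f Fin.zero))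
... | true  = cong suc (length-filter-tabulate P? (f ∘ Fin.suc))
... | false = length-filter-tabulate P? (f ∘ Fin.suc)

length-filter-permute : ∀ {n p} {P : Pred (Fin n) p} (P? : Decidable P) (ρ : Permutation′ n) →
                        length (filter (P? ∘ (ρ ⟨$⟩ʳ_)) (allFin n)) ≡ length (filter P? (allFin n))
length-filter-permute P? ρ = begin
  length (filter (P? ∘ (ρ ⟨$⟩ʳ_)) (allFin _))  ≡⟨ length-filter-tabulate (P? ∘ (ρ ⟨$⟩ʳ_)) id ⟩
  sum (indicator P? ∘ (ρ ⟨$⟩ʳ_))               ≡⟨ sum-permute (indicator P?) ρ ⟨
  sum (indicator P?)                           ≡⟨ length-filter-tabulate P? id ⟨
  length (filter P? (allFin _))                ∎
  where open ≡-Reasoning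

lookup-allPairs : ∀ {a r} {A : Set a} {R : Rel A r} {xs : List A} → AllPairs R xs →
                  ∀ {i j} → i Fin.< j → R (lookup xs i) (lookup xs j)
lookup-allPairs {xs = _ ∷ xs} (Rx ∷ _)   {Fin.zero}  {Fin.suc j} _         = All.lookup Rx (∈-lookup {xs = xs} j)
lookup-allPairs               (_ ∷ Rxs) {Fin.suc i} {Fin.suc j} (s≤s i<j) = lookup-allPairs Rxs i<j

lookup-injective : ∀ {a r} {A : Set a} {R : Rel A r} → Symmetric R →
                   ∀ {xs : List A} → AllPairs (λ x y → ¬ R x y) xs →
                   ∀ i j → R (lookup xs i) (lookup xs j) → i ≡ j
lookup-injective R-sym distinct i j Rij with Fin.<-cmp i j
... | tri< i<j _ _ = contradiction Rij (lookup-allPairs distinct i<j)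
... | tri≈ _ i≡j _ = i≡j
... | tri> _ _ j<i = contradiction (R-sym Rij) (lookup-allPairs distinct j<i)

-- Permutations as maps on ℕ

at-fromℕ< : ∀ {n} (π : Permutation′ n) {j} (j<n : j < n) → at π j ≡ toℕ (π ⟨$⟩ʳ fromℕ< j<n)
at-fromℕ< {n} π {j} j<n with j <? n
... | yes _   = refl
... | no j≮n = contradiction j<n j≮n

at-toℕ : ∀ {n} (π : Permutation′ n) x → at π (toℕ x) ≡ toℕ (π ⟨$⟩ʳ x)
at-toℕ π x = trans (at-fromℕ< π (toℕ<n x)) (cong (toℕ ∘ (π ⟨$⟩ʳ_)) (fromℕ<-toℕ x (toℕ<n x)))

at-< : ∀ {n} (π : Permutation′ n) {j} → j < n → at π j < n
at-< {n} π j<n = subst (_< n) (sym (at-fromℕ< π j<n)) (toℕ<n _)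

at-flip : ∀ {n} (π : Permutation′ n) {j} → j < n → at (flip π) (at π j) ≡ j
at-flip π {j} j<n = begin
  at (flip π) (at π j)          ≡⟨ cong (at (flip π)) (at-fromℕ< π j<n) ⟩
  at (flip π) (toℕ (π ⟨$⟩ʳ x))  ≡⟨ at-toℕ (flip π) _ ⟩
  toℕ (π ⟨$⟩ˡ (π ⟨$⟩ʳ x))       ≡⟨ cong toℕ (inverseˡ π) ⟩
  toℕ x                         ≡⟨ toℕ-fromℕ< j<n ⟩
  j                             ∎
  where
  open ≡-Reasoning
  x = fromℕ< j<n

at-injective : ∀ {n} (π : Permutation′ n) {j k} → j < n → k < n → at π j ≡ at π k → j ≡ k
at-injective π j<n k<n eq = trans (sym (at-flip π j<n)) (trans (cong (at (flip π)) eq) (at-flip π k<n))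

module _ {n} {π π′ : Permutation′ n} where

  at-cong : π ≈ π′ → ∀ {j} → j < n → at π j ≡ at π′ j
  at-cong π≈π′ j<n = trans (at-fromℕ< π j<n) (trans (cong toℕ (π≈π′ _)) (sym (at-fromℕ< π′ j<n)))

  at-≗⇒≈ : (∀ {j} → j < n → at π j ≡ at π′ j) → π ≈ π′
  at-≗⇒≈ eq x = toℕ-injective (trans (sym (at-toℕ π x)) (trans (eq (toℕ<n x)) (at-toℕ π′ x)))

at-∘ₚ : ∀ {n} (π ρ : Permutation′ n) {j} → j < n → at (π ∘ₚ ρ) j ≡ at ρ (at π j)
at-∘ₚ π ρ j<n = trans (at-fromℕ< (π ∘ₚ ρ) j<n) (trans (sym (at-toℕ ρ _)) (cong (at ρ) (sym (at-fromℕ< π j<n))))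

∘ₚ-cancelˡ : ∀ {n} {ε ε′ π π′ : Permutation′ n} → ε ≈ ε′ → ε ∘ₚ π ≈ ε′ ∘ₚ π′ → π ≈ π′
∘ₚ-cancelˡ {ε = ε} {ε′} {π} {π′} ε≈ε′ eq x = begin
  π ⟨$⟩ʳ x                   ≡⟨ cong (π ⟨$⟩ʳ_) (inverseʳ ε) ⟨
  π ⟨$⟩ʳ (ε ⟨$⟩ʳ y)          ≡⟨ eq y ⟩
  π′ ⟨$⟩ʳ (ε′ ⟨$⟩ʳ y)        ≡⟨ cong (π′ ⟨$⟩ʳ_) (trans (sym (ε≈ε′ y)) (inverseʳ ε)) ⟩
  π′ ⟨$⟩ʳ x                  ∎
  where
  open ≡-Reasoning
  y = ε ⟨$⟩ˡ x

module FromInverses (n : ℕ) {f g : ℕ → ℕ}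
         (f< : ∀ {x} → x < n → f x < n) (g< : ∀ {x} → x < n → g x < n)
         (gf : ∀ {x} → x < n → g (f x) ≡ x) (fg : ∀ {x} → x < n → f (g x) ≡ x) where

  permutationᴺ : Permutation′ n
  permutationᴺ = permutation (lift f f<) (lift g g<) (inverse f< g< fg) (inverse g< f< gf)
    where
    lift : (h : ℕ → ℕ) → (∀ {x} → x < n → h x < n) → Fin n → Fin n
    lift h h< x = fromℕ< (h< (toℕ<n x))
    inverse : ∀ {h k} (h< : ∀ {x} → x < n → h x < n) (k< : ∀ {x} → x < n → k x < n) →
              (∀ {x} → x < n → h (k x) ≡ x) → ∀ x → lift h h< (lift k k< x) ≡ x
    inverse {h} h< k< hk x = toℕ-injective (trans (toℕ-fromℕ< _) (trans (cong h (toℕ-fromℕ< _)) (hk (toℕ<n x))))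

  at-permutationᴺ : ∀ {x} → x < n → at permutationᴺ x ≡ f x
  at-permutationᴺ x<n = trans (at-fromℕ< permutationᴺ x<n) (trans (toℕ-fromℕ< _) (cong f (toℕ-fromℕ< x<n)))

onWindow : (i M : ℕ) → (ℕ → ℕ) → ℕ → ℕ
onWindow i M f x with x <? i
... | yes _ = x
... | no _ with x ∸ i <? M
...   | yes _ = i + f (x ∸ i)
...   | no _  = x

module _ (i M : ℕ) where

  data WindowView : ℕ → Set where
    outside : ∀ {x} → (∀ f → onWindow i M f x ≡ x) → WindowView x
    inside  : ∀ {y} → y < M → WindowView (i + y)

  private
    onWindow-below : ∀ {x} → x < i → ∀ f → onWindow i M f x ≡ x
    onWindow-below {x} x<i f with x <? i
    ... | yes _   = refl
    ... | no x≮i = contradiction x<i x≮i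

    onWindow-above : ∀ {x} → ¬ x < i → ¬ x ∸ i < M → ∀ f → onWindow i M f x ≡ x
    onWindow-above {x} x≮i y≮M f with x <? i
    ... | yes x<i = contradiction x<i x≮i
    ... | no _ with x ∸ i <? M
    ...   | yes y<M = contradiction y<M y≮M
    ...   | no _    = refl

  windowView : ∀ x → WindowView x
  windowView x with x <? i
  ... | yes x<i = outside (onWindow-below x<i)
  ... | no x≮i with x ∸ i <? M
  ...   | yes y<M = subst WindowView (m+[n∸m]≡n (≮⇒≥ x≮i)) (inside y<M)
  ...   | no y≮M  = outside (onWindow-above x≮i y≮M)

  onWindow-inside : ∀ f {y} → y < M → onWindow i M f (i + y) ≡ i + f y
  onWindow-inside f {y} y<M with i + y <? i
  ... | yes i+y<i = contradiction (m≤m+n i y) (<⇒≱ i+y<i)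
  ... | no _ with i + y ∸ i <? M
  ...   | yes _   = cong (λ z → i + f z) (m+n∸m≡n i y)
  ...   | no y≮M = contradiction (subst (_< M) (sym (m+n∸m≡n i y)) y<M) y≮M

  onWindow-cong : ∀ {f g} → (∀ {y} → y < M → f y ≡ g y) → ∀ x → onWindow i M f x ≡ onWindow i M g x
  onWindow-cong {f} {g} f≗g x with windowView x
  ... | outside fixed = trans (fixed f) (sym (fixed g))
  ... | inside y<M    = trans (onWindow-inside f y<M)
                          (trans (cong (i +_) (f≗g y<M)) (sym (onWindow-inside g y<M)))

  onWindow-< : ∀ {n f} → i + M ≤ n → (∀ {y} → y < M → f y < M) →
               ∀ {x} → x < n → onWindow i M f x < n
  onWindow-< {n} {f} i+M≤n f< {x} x<n with windowView x
  ... | outside fixed = subst (_< n) (sym (fixed f)) x<n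
  ... | inside y<M    = subst (_< n) (sym (onWindow-inside f y<M)) (<-≤-trans (+-monoʳ-< i (f< y<M)) i+M≤n)

  onWindow-inverse : ∀ {f g} → (∀ {y} → y < M → f y < M) → (∀ {y} → y < M → g (f y) ≡ y) →
                     ∀ x → onWindow i M g (onWindow i M f x) ≡ x
  onWindow-inverse {f} {g} f< gf x with windowView x
  ... | outside fixed = trans (cong (onWindow i M g) (fixed f)) (fixed g)
  ... | inside y<M    = trans (cong (onWindow i M g) (onWindow-inside f y<M))
                          (trans (onWindow-inside g (f< y<M)) (cong (i +_) (gf y<M)))

module WindowShuffle {n i M : ℕ} (i+M≤n : i + M ≤ n) where

  module _ (ρ : Permutation′ M) where
    open FromInverses n (onWindow-< i M i+M≤n (at-< ρ)) (onWindow-< i M i+M≤n (at-< (flip ρ)))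
                        (λ {x} _ → onWindow-inverse i M (at-< ρ) (at-flip ρ) x)
                        (λ {x} _ → onWindow-inverse i M (at-< (flip ρ)) (at-flip (flip ρ)) x)
      public renaming (permutationᴺ to extend; at-permutationᴺ to at-extend)

  extend-cong : ∀ {ρ ρ′} → ρ ≈ ρ′ → extend ρ ≈ extend ρ′
  extend-cong {ρ} {ρ′} ρ≈ρ′ = at-≗⇒≈ λ {x} x<n → begin
    at (extend ρ) x           ≡⟨ at-extend ρ x<n ⟩
    onWindow i M (at ρ) x     ≡⟨ onWindow-cong i M (at-cong ρ≈ρ′) x ⟩
    onWindow i M (at ρ′) x    ≡⟨ at-extend ρ′ x<n ⟨
    at (extend ρ′) x          ∎
    where open ≡-Reasoning

  shuffle : Permutation′ n → Permutation′ M → Permutation′ n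
  shuffle π ρ = extend ρ ∘ₚ π

  at-shuffle : ∀ π ρ {y} → y < M → at (shuffle π ρ) (i + y) ≡ at π (i + at ρ y)
  at-shuffle π ρ {y} y<M = begin
    at (extend ρ ∘ₚ π) (i + y)          ≡⟨ at-∘ₚ (extend ρ) π i+y<n ⟩
    at π (at (extend ρ) (i + y))        ≡⟨ cong (at π) (at-extend ρ i+y<n) ⟩
    at π (onWindow i M (at ρ) (i + y))  ≡⟨ cong (at π) (onWindow-inside i M (at ρ) y<M) ⟩
    at π (i + at ρ y)                   ∎
    where
    open ≡-Reasoning
    i+y<n = <-≤-trans (+-monoʳ-< i y<M) i+M≤n

  shuffle-cancelʳ : ∀ {π π′ ρ ρ′} → ρ ≈ ρ′ → shuffle π ρ ≈ shuffle π′ ρ′ → π ≈ π′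
  shuffle-cancelʳ {π} {π′} {ρ} {ρ′} ρ≈ρ′ = ∘ₚ-cancelˡ {ε = extend ρ} {extend ρ′} {π} {π′} (extend-cong {ρ} {ρ′} ρ≈ρ′)

-- Lehmer codes

remQuot-injective : ∀ {m} n {x y : Fin (m * n)} → remQuot {m} n x ≡ remQuot n y → x ≡ y
remQuot-injective {m} n {x} {y} eq =
  trans (sym (combine-remQuot {m} n x)) (trans (cong (uncurry combine) eq) (combine-remQuot {m} n y))

remove-cong : ∀ {k} i {π π′ : Permutation′ (suc k)} → π ≈ π′ → remove i π ≈ remove i π′
remove-cong i π≈π′ j = punchOut-cong₂ (π≈π′ i) (π≈π′ (punchIn i j))
  where
  punchOut-cong₂ : ∀ {k} {a a′ b b′ : Fin (suc k)} {a≢b : a ≢ b} {a′≢b′ : a′ ≢ b′} →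
                   a ≡ a′ → b ≡ b′ → punchOut a≢b ≡ punchOut a′≢b′
  punchOut-cong₂ {a = a} refl refl = punchOut-cong a refl

insert-cong : ∀ {k} i j {π π′ : Permutation′ k} → π ≈ π′ → insert i j π ≈ insert i j π′
insert-cong i j π≈π′ x with i Fin.≟ x
... | yes _   = refl
... | no i≢x = cong (punchIn j) (π≈π′ (punchOut i≢x))

insert-at : ∀ {k} i j (π : Permutation′ k) → insert i j π ⟨$⟩ʳ i ≡ j
insert-at i j π with i Fin.≟ i
... | yes _   = refl
... | no i≢i = contradiction refl i≢i

encode : ∀ k → Permutation′ k → Fin (k !)
encode zero    π = Fin.zero
encode (suc k) π = combine (π ⟨$⟩ʳ Fin.zero) (encode k (remove Fin.zero π))

encode-injective : ∀ k {π π′ : Permutation′ k} → encode k π ≡ encode k π′ → π ≈ π′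
encode-injective zero    _  ()
encode-injective (suc k) {π} {π′} eq x with combine-injective {suc k} {k !} _ _ _ _ eq
... | π0≡π′0 , rest≡ = begin
  π ⟨$⟩ʳ x                                            ≡⟨ insert-remove Fin.zero π x ⟨
  insert Fin.zero (π ⟨$⟩ʳ Fin.zero) (remove Fin.zero π) ⟨$⟩ʳ x
    ≡⟨ insert-cong Fin.zero _ (encode-injective k rest≡) x ⟩
  insert Fin.zero (π ⟨$⟩ʳ Fin.zero) (remove Fin.zero π′) ⟨$⟩ʳ x
    ≡⟨ cong (λ j → insert Fin.zero j (remove Fin.zero π′) ⟨$⟩ʳ x) π0≡π′0 ⟩
  insert Fin.zero (π′ ⟨$⟩ʳ Fin.zero) (remove Fin.zero π′) ⟨$⟩ʳ x
    ≡⟨ insert-remove Fin.zero π′ x ⟩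
  π′ ⟨$⟩ʳ x                                           ∎
  where open ≡-Reasoning

decode : ∀ k → Fin (k !) → Permutation′ k
decode zero    _ = Perm.id
decode (suc k) x = insert Fin.zero (proj₁ jr) (decode k (proj₂ jr))
  where jr = remQuot {suc k} (k !) x

decode-injective : ∀ k {x y : Fin (k !)} → decode k x ≈ decode k y → x ≡ y
decode-injective zero    {Fin.zero} {Fin.zero} _ = refl
decode-injective (suc k) {x} {y} eq = remQuot-injective {suc k} (k !) (cong₂ _,_ j≡j′ r≡r′)
  where
  j = proj₁ (remQuot {suc k} (k !) x)
  r = proj₂ (remQuot {suc k} (k !) x)
  j′ = proj₁ (remQuot {suc k} (k !) y)
  r′ = proj₂ (remQuot {suc k} (k !) y)
  j≡j′ : j ≡ j′
  j≡j′ = trans (sym (insert-at Fin.zero j (decode k r))) (trans (eq Fin.zero) (insert-at Fin.zero j′ (decode k r′)))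
  r≡r′ : r ≡ r′
  r≡r′ = decode-injective k λ z →
    trans (sym (remove-insert Fin.zero j (decode k r) z))
      (trans (remove-cong Fin.zero {decode (suc k) x} {decode (suc k) y} eq z)
        (remove-insert Fin.zero j′ (decode k r′) z))

-- Monotone maps and lattice paths

-- Number of monotone maps {0, …, ℓ - 1} → {0, …, r}; in particular paths d d = C(2d, d).
paths : ℕ → ℕ → ℕ
paths zero    r       = 1
paths (suc ℓ) zero    = 1
paths (suc ℓ) (suc r) = paths ℓ (suc r) + paths (suc ℓ) r

paths-factorial : ∀ ℓ r → paths ℓ r * (ℓ ! * r !) ≡ (ℓ + r) !
paths-factorial zero    r       = trans (*-identityˡ _) (*-identityˡ (r !))
paths-factorial (suc ℓ) zero    = trans (*-identityˡ _) (trans (*-identityʳ _) (cong _! (sym (+-identityʳ (suc ℓ)))))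
paths-factorial (suc ℓ) (suc r) = begin
  (paths ℓ (suc r) + paths (suc ℓ) r) * ((suc ℓ * ℓ !) * (suc r * r !))
    ≡⟨ pascal (paths ℓ (suc r)) (paths (suc ℓ) r) ℓ r (ℓ !) (r !) ⟩
  suc ℓ * (paths ℓ (suc r) * (ℓ ! * suc r !)) + suc r * (paths (suc ℓ) r * (suc ℓ ! * r !))
    ≡⟨ cong₂ (λ x y → suc ℓ * x + suc r * y) (paths-factorial ℓ (suc r)) (paths-factorial (suc ℓ) r) ⟩
  suc ℓ * (ℓ + suc r) ! + suc r * (suc ℓ + r) !
    ≡⟨ cong (λ x → suc ℓ * x ! + suc r * (suc ℓ + r) !) (+-suc ℓ r) ⟩
  suc ℓ * (suc ℓ + r) ! + suc r * (suc ℓ + r) !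
    ≡⟨ *-distribʳ-+ ((suc ℓ + r) !) (suc ℓ) (suc r) ⟨
  (suc ℓ + suc r) * (suc ℓ + r) !
    ≡⟨ cong (λ x → (suc ℓ + suc r) * x !) (+-suc ℓ r) ⟨
  (suc ℓ + suc r) !
    ∎
  where
  open ≡-Reasoning
  pascal : ∀ p q ℓ r a b →
           (p + q) * ((suc ℓ * a) * (suc r * b)) ≡ suc ℓ * (p * (a * (suc r * b))) + suc r * (q * ((suc ℓ * a) * b))
  pascal = solve-∀

Monotone : (ℕ → ℕ) → Set
Monotone f = ∀ x → f x ≤ f (suc x)

monotone-f0≤ : ∀ {f} → Monotone f → ∀ x → f 0 ≤ f x
monotone-f0≤ mono zero    = ≤-refl
monotone-f0≤ mono (suc x) = ≤-trans (monotone-f0≤ mono x) (mono x)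

↑ˡ≢↑ʳ : ∀ {a b} (x : Fin a) (y : Fin b) → x ↑ˡ b ≢ a ↑ʳ y
↑ˡ≢↑ʳ {a} {b} x y eq = <⇒≢ (begin-strict
  toℕ (x ↑ˡ b)  ≡⟨ toℕ-↑ˡ x b ⟩
  toℕ x         <⟨ toℕ<n x ⟩
  a             ≤⟨ m≤m+n a (toℕ y) ⟩
  a + toℕ y     ≡⟨ toℕ-↑ʳ a y ⟨
  toℕ (a ↑ʳ y)  ∎) (cong toℕ eq)
  where open ≤-Reasoning

-- Pascal's rule: either f 0 = 0 and f ∘ suc is a monotone map on ℓ points into {0, …, r + 1},
-- or f ≥ 1 and pred ∘ f is a monotone map on ℓ + 1 points into {0, …, r}.
encodeMonotone : ∀ ℓ r → (ℕ → ℕ) → Fin (paths ℓ r)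
encodeMonotone zero    r       f = Fin.zero
encodeMonotone (suc ℓ) zero    f = Fin.zero
encodeMonotone (suc ℓ) (suc r) f with f 0
... | zero  = encodeMonotone ℓ (suc r) (f ∘ suc) ↑ˡ paths (suc ℓ) r
... | suc _ = paths ℓ (suc r) ↑ʳ encodeMonotone (suc ℓ) r (pred ∘ f)

encodeMonotone-injective : ∀ ℓ r {f g} → Monotone f → Monotone g → (∀ x → f x ≤ r) → (∀ x → g x ≤ r) →
                           encodeMonotone ℓ r f ≡ encodeMonotone ℓ r g → ∀ {x} → x < ℓ → f x ≡ g x
encodeMonotone-injective (suc ℓ) zero {f} {g} _ _ f≤0 g≤0 _ {x} _ = trans (n≤0⇒n≡0 (f≤0 x)) (sym (n≤0⇒n≡0 (g≤0 x)))
encodeMonotone-injective (suc ℓ) (suc r) {f} {g} f-mono g-mono f≤ g≤ eq {x} x<1+ℓ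
  with f 0 in f0≡ | g 0 in g0≡
... | zero  | suc _ = contradiction eq (↑ˡ≢↑ʳ _ _)
... | suc _ | zero  = contradiction (sym eq) (↑ˡ≢↑ʳ _ _)
... | zero  | zero  with x
...   | zero  = trans f0≡ (sym g0≡)
...   | suc y = encodeMonotone-injective ℓ (suc r) (f-mono ∘ suc) (g-mono ∘ suc) (f≤ ∘ suc) (g≤ ∘ suc)
                  (↑ˡ-injective (paths (suc ℓ) r) _ _ eq) (s≤s⁻¹ x<1+ℓ)
encodeMonotone-injective (suc ℓ) (suc r) {f} {g} f-mono g-mono f≤ g≤ eq {x} x<1+ℓ
    | suc _ | suc _ = begin
  f x                ≡⟨ suc-pred (f x) {{positive f-mono f0≡}} ⟨
  suc (pred (f x))   ≡⟨ cong suc (encodeMonotone-injective (suc ℓ) r (pred-mono-≤ ∘ f-mono) (pred-mono-≤ ∘ g-mono)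
                                    (pred-mono-≤ ∘ f≤) (pred-mono-≤ ∘ g≤) (↑ʳ-injective (paths ℓ (suc r)) _ _ eq) x<1+ℓ) ⟩
  suc (pred (g x))   ≡⟨ suc-pred (g x) {{positive g-mono g0≡}} ⟩
  g x                ∎
  where
  open ≡-Reasoning
  positive : ∀ {h a} → Monotone h → h 0 ≡ suc a → NonZero (h x)
  positive h-mono h0≡ = >-nonZero (<-≤-trans (subst (0 <_) (sym h0≡) z<s) (monotone-f0≤ h-mono x))

-- Wallis products

ratio-mono : (x y : ℕ → ℕ) → (∀ t → 0 < y t) → (∀ t → x t * y (suc t) ≤ x (suc t) * y t) →
             ∀ {s t} → s ≤ t → x s * y t ≤ x t * y s
ratio-mono x y y>0 step {s} s≤t = go (≤⇒≤′ s≤t)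
  where
  go : ∀ {t} → s ≤′ t → x s * y t ≤ x t * y s
  go ≤′-refl             = ≤-refl
  go (≤′-step {t} s≤′t) = *-cancelʳ-≤ _ _ (y t) {{>-nonZero (y>0 t)}} (begin
    x s * y (suc t) * y t    ≡⟨ swap (x s) (y (suc t)) (y t) ⟩
    x s * y t * y (suc t)    ≤⟨ *-monoˡ-≤ (y (suc t)) (go s≤′t) ⟩
    x t * y s * y (suc t)    ≡⟨ swap (x t) (y s) (y (suc t)) ⟩
    x t * y (suc t) * y s    ≤⟨ *-monoˡ-≤ (y s) (step t) ⟩
    x (suc t) * y t * y s    ≡⟨ swap (x (suc t)) (y t) (y s) ⟩
    x (suc t) * y s * y t    ∎)
    where
    open ≤-Reasoning
    swap : ∀ a b c → a * b * c ≡ a * c * b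
    swap = solve-∀

wallisNum-pos : ∀ t → 0 < wallisNum t
wallisNum-pos zero    = z<s
wallisNum-pos (suc t) = *-mono-< (wallisNum-pos t) z<s

wallisDen-suc : ∀ t → wallisDen (suc t) ≡ wallisDen t * ((1 + (t + t)) * (3 + (t + t)))
wallisDen-suc t = cong (λ c → wallisDen t * (c ∸ 1)) (square t)
  where
  square : ∀ t → 4 * (suc t * suc t) ≡ suc ((1 + (t + t)) * (3 + (t + t)))
  square = solve-∀

wallisDen-pos : ∀ t → 0 < wallisDen t
wallisDen-pos zero    = z<s
wallisDen-pos (suc t) = subst (0 <_) (sym (wallisDen-suc t)) (*-mono-< (wallisDen-pos t) z<s)

wallisNum≡ : ∀ d → wallisNum d ≡ 4 ^ d * (d ! * d !)
wallisNum≡ zero    = refl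
wallisNum≡ (suc t) = begin
  wallisNum t * (4 * (suc t * suc t))            ≡⟨ cong (_* (4 * (suc t * suc t))) (wallisNum≡ t) ⟩
  4 ^ t * (t ! * t !) * (4 * (suc t * suc t))    ≡⟨ regroup (4 ^ t) (t !) t ⟩
  4 * 4 ^ t * ((suc t * t !) * (suc t * t !))    ∎
  where
  open ≡-Reasoning
  regroup : ∀ p f t → p * (f * f) * (4 * (suc t * suc t)) ≡ 4 * p * ((suc t * f) * (suc t * f))
  regroup = solve-∀

double-factorial-square : ∀ d → (d + d) ! * (d + d) ! * (1 + (d + d)) ≡ 4 ^ d * (d ! * d !) * wallisDen d
double-factorial-square zero    = refl
double-factorial-square (suc d) = begin
  (suc d + suc d) ! * (suc d + suc d) ! * (1 + (suc d + suc d))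
    ≡⟨ cong (λ x → x ! * x ! * suc x) (cong suc (+-suc d d)) ⟩
  (2 + (d + d)) * ((1 + (d + d)) * F) * ((2 + (d + d)) * ((1 + (d + d)) * F)) * (3 + (d + d))
    ≡⟨ regroupˡ d F ⟩
  c * (F * F * (1 + (d + d)))
    ≡⟨ cong (c *_) (double-factorial-square d) ⟩
  c * (4 ^ d * (d ! * d !) * wallisDen d)
    ≡⟨ regroupʳ d (4 ^ d) (d !) (wallisDen d) ⟩
  4 * 4 ^ d * ((suc d * d !) * (suc d * d !)) * (wallisDen d * ((1 + (d + d)) * (3 + (d + d))))
    ≡⟨ cong (4 ^ suc d * (suc d ! * suc d !) *_) (wallisDen-suc d) ⟨
  4 ^ suc d * (suc d ! * suc d !) * wallisDen (suc d)
    ∎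
  where
  open ≡-Reasoning
  F = (d + d) !
  c = 4 * (suc d * suc d) * ((1 + (d + d)) * (3 + (d + d)))
  regroupˡ : ∀ d F → (2 + (d + d)) * ((1 + (d + d)) * F) * ((2 + (d + d)) * ((1 + (d + d)) * F)) * (3 + (d + d))
                   ≡ 4 * (suc d * suc d) * ((1 + (d + d)) * (3 + (d + d))) * (F * F * (1 + (d + d)))
  regroupˡ = solve-∀
  regroupʳ : ∀ d p f w → 4 * (suc d * suc d) * ((1 + (d + d)) * (3 + (d + d))) * (p * (f * f) * w)
                       ≡ 4 * p * ((suc d * f) * (suc d * f)) * (w * ((1 + (d + d)) * (3 + (d + d))))
  regroupʳ = solve-∀

paths-central-square : ∀ d → paths d d * paths d d * (1 + (d + d)) * wallisNum d ≡ 16 ^ d * wallisDen d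
paths-central-square d = *-cancelʳ-≡ _ _ (d ! * d !) {{m*n≢0 (d !) (d !) {{d !≢0}} {{d !≢0}}}} (begin
  Q * Q * (1 + (d + d)) * wallisNum d * (d ! * d !)
    ≡⟨ cong (λ w → Q * Q * (1 + (d + d)) * w * (d ! * d !)) (wallisNum≡ d) ⟩
  Q * Q * (1 + (d + d)) * (4 ^ d * (d ! * d !)) * (d ! * d !)
    ≡⟨ regroupˡ Q d (4 ^ d) (d ! * d !) ⟩
  4 ^ d * ((Q * (d ! * d !)) * (Q * (d ! * d !)) * (1 + (d + d)))
    ≡⟨ cong (λ x → 4 ^ d * (x * x * (1 + (d + d)))) (paths-factorial d d) ⟩
  4 ^ d * ((d + d) ! * (d + d) ! * (1 + (d + d)))
    ≡⟨ cong (4 ^ d *_) (double-factorial-square d) ⟩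
  4 ^ d * (4 ^ d * (d ! * d !) * wallisDen d)
    ≡⟨ regroupʳ (4 ^ d) (d ! * d !) (wallisDen d) ⟩
  (4 ^ d * 4 ^ d) * wallisDen d * (d ! * d !)
    ≡⟨ cong (λ p → p * wallisDen d * (d ! * d !)) (sixteen^ d) ⟨
  16 ^ d * wallisDen d * (d ! * d !)
    ∎)
  where
  open ≡-Reasoning
  Q = paths d d
  regroupˡ : ∀ q d p g → q * q * (1 + (d + d)) * (p * g) * g ≡ p * ((q * g) * (q * g) * (1 + (d + d)))
  regroupˡ = solve-∀
  regroupʳ : ∀ p g w → p * (p * g * w) ≡ (p * p) * w * g
  regroupʳ = solve-∀
  sixteen^ : ∀ d → 16 ^ d ≡ 4 ^ d * 4 ^ d
  sixteen^ zero    = refl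
  sixteen^ (suc d) = trans (cong (16 *_) (sixteen^ d)) (square (4 ^ d))
    where
    square : ∀ p → 16 * (p * p) ≡ (4 * p) * (4 * p)
    square = solve-∀

wallis-lower-mono : ∀ {s t} → s ≤ t → wallisNum s * wallisDen t ≤ wallisNum t * wallisDen s
wallis-lower-mono = ratio-mono wallisNum wallisDen wallisDen-pos step
  where
  step : ∀ t → wallisNum t * wallisDen (suc t) ≤ wallisNum (suc t) * wallisDen t
  step t = begin
    wallisNum t * (wallisDen t * (c ∸ 1))  ≤⟨ *-monoʳ-≤ (wallisNum t) (*-monoʳ-≤ (wallisDen t) (m∸n≤m c 1)) ⟩
    wallisNum t * (wallisDen t * c)        ≡⟨ regroup (wallisNum t) (wallisDen t) c ⟩
    wallisNum t * c * wallisDen t          ∎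
    where
    open ≤-Reasoning
    c = 4 * (suc t * suc t)
    regroup : ∀ w v c → w * (v * c) ≡ w * c * v
    regroup = solve-∀

wallis-upper-antitone : ∀ {s t} → s ≤ t →
  s * wallisDen s * (wallisNum t * (1 + (t + t))) ≤ t * wallisDen t * (wallisNum s * (1 + (s + s)))
wallis-upper-antitone = ratio-mono (λ t → t * wallisDen t) (λ t → wallisNum t * (1 + (t + t))) positive step
  where
  positive : ∀ t → 0 < wallisNum t * (1 + (t + t))
  positive t = *-mono-< (wallisNum-pos t) z<s
  step : ∀ t → t * wallisDen t * (wallisNum (suc t) * (1 + (suc t + suc t)))
             ≤ suc t * wallisDen (suc t) * (wallisNum t * (1 + (t + t)))
  step t = begin
    t * v * (w * (4 * (suc t * suc t)) * (1 + (suc t + suc t)))  ≡⟨ regroupˡ t v w ⟩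
    v * w * (3 + (t + t)) * (t * (4 * (suc t * suc t)))          ≤⟨ *-monoʳ-≤ (v * w * (3 + (t + t))) (m≤m+n _ (suc t)) ⟩
    v * w * (3 + (t + t)) * (t * (4 * (suc t * suc t)) + suc t)  ≡⟨ regroupʳ t v w ⟩
    suc t * (v * ((1 + (t + t)) * (3 + (t + t)))) * (w * (1 + (t + t)))
      ≡⟨ cong (λ v′ → suc t * v′ * (w * (1 + (t + t)))) (wallisDen-suc t) ⟨
    suc t * wallisDen (suc t) * (w * (1 + (t + t)))               ∎
    where
    open ≤-Reasoning
    v = wallisDen t
    w = wallisNum t
    regroupˡ : ∀ t v w → t * v * (w * (4 * (suc t * suc t)) * (1 + (suc t + suc t)))
                       ≡ v * w * (3 + (t + t)) * (t * (4 * (suc t * suc t)))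
    regroupˡ = solve-∀
    regroupʳ : ∀ t v w → v * w * (3 + (t + t)) * (t * (4 * (suc t * suc t)) + suc t)
                       ≡ suc t * (v * ((1 + (t + t)) * (3 + (t + t)))) * (w * (1 + (t + t)))
    regroupʳ = solve-∀

-- W_N / D_N < π/2 < (2d + 1) / (2d) · W_d / D_d
wallis-lower≤upper : ∀ d N → (d + d) * wallisDen d * wallisNum N ≤ (1 + (d + d)) * wallisNum d * wallisDen N
wallis-lower≤upper d N with N ≤? d
... | yes N≤d = begin
  (d + d) * wallisDen d * wallisNum N    ≡⟨ regroup (d + d) (wallisDen d) (wallisNum N) ⟩
  (d + d) * (wallisNum N * wallisDen d)  ≤⟨ *-monoʳ-≤ (d + d) (wallis-lower-mono N≤d) ⟩
  (d + d) * (wallisNum d * wallisDen N)  ≤⟨ *-monoˡ-≤ _ (n≤1+n (d + d)) ⟩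
  (1 + (d + d)) * (wallisNum d * wallisDen N) ≡⟨ *-assoc (1 + (d + d)) (wallisNum d) (wallisDen N) ⟨
  (1 + (d + d)) * wallisNum d * wallisDen N   ∎
  where
  open ≤-Reasoning
  regroup : ∀ a v w → a * v * w ≡ a * (w * v)
  regroup = solve-∀
... | no N≰d = *-cancelʳ-≤ _ _ (1 + (N + N)) (begin
  (d + d) * wallisDen d * wallisNum N * (1 + (N + N))                ≡⟨ regroupˡ d N (wallisDen d) (wallisNum N) ⟩
  2 * (d * wallisDen d * (wallisNum N * (1 + (N + N))))              ≤⟨ *-monoʳ-≤ 2 (wallis-upper-antitone (<⇒≤ (≰⇒> N≰d))) ⟩
  2 * (N * wallisDen N * (wallisNum d * (1 + (d + d))))              ≡⟨ regroupʳ d N (wallisDen N) (wallisNum d) ⟩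
  (N + N) * ((1 + (d + d)) * wallisNum d * wallisDen N)              ≤⟨ *-monoˡ-≤ _ (n≤1+n (N + N)) ⟩
  (1 + (N + N)) * ((1 + (d + d)) * wallisNum d * wallisDen N)        ≡⟨ *-comm (1 + (N + N)) _ ⟩
  (1 + (d + d)) * wallisNum d * wallisDen N * (1 + (N + N))          ∎)
  where
  open ≤-Reasoning
  regroupˡ : ∀ d N v w → (d + d) * v * w * (1 + (N + N)) ≡ 2 * (d * v * (w * (1 + (N + N))))
  regroupˡ = solve-∀
  regroupʳ : ∀ d N v w → 2 * (N * v * (w * (1 + (d + d)))) ≡ (N + N) * ((1 + (d + d)) * w * v)
  regroupʳ = solve-∀

-- C(2d, d) ≤ 4^d / √(π d), with π/2 replaced by its Wallis approximant W_N / D_N.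
central-binomial-bound : ∀ d N → paths d d * paths d d * (2 * wallisNum N) * d ≤ 16 ^ d * wallisDen N
central-binomial-bound d N = *-cancelʳ-≤ _ _ K {{>-nonZero (*-mono-< {0} {1 + (d + d)} z<s (wallisNum-pos d))}} (begin
  Q * Q * (2 * wallisNum N) * d * K                          ≡⟨ regroupˡ Q d (wallisNum N) (wallisNum d) ⟩
  Q * Q * (1 + (d + d)) * wallisNum d * ((d + d) * wallisNum N)
    ≡⟨ cong (_* ((d + d) * wallisNum N)) (paths-central-square d) ⟩
  16 ^ d * wallisDen d * ((d + d) * wallisNum N)              ≡⟨ regroupᵐ (16 ^ d) (wallisDen d) d (wallisNum N) ⟩
  16 ^ d * ((d + d) * wallisDen d * wallisNum N)              ≤⟨ *-monoʳ-≤ (16 ^ d) (wallis-lower≤upper d N) ⟩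
  16 ^ d * ((1 + (d + d)) * wallisNum d * wallisDen N)        ≡⟨ regroupʳ (16 ^ d) d (wallisNum d) (wallisDen N) ⟩
  16 ^ d * wallisDen N * K                                    ∎)
  where
  open ≤-Reasoning
  Q = paths d d
  K = (1 + (d + d)) * wallisNum d
  regroupˡ : ∀ q d w u → q * q * (2 * w) * d * ((1 + (d + d)) * u) ≡ q * q * (1 + (d + d)) * u * ((d + d) * w)
  regroupˡ = solve-∀
  regroupᵐ : ∀ p v d w → p * v * ((d + d) * w) ≡ p * ((d + d) * v * w)
  regroupᵐ = solve-∀
  regroupʳ : ∀ p d u v → p * ((1 + (d + d)) * u * v) ≡ p * v * ((1 + (d + d)) * u)
  regroupʳ = solve-∀

rank : (ℕ → ℕ) → ℕ → ℕ → ℕ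
rank w L c = length (filter (λ b → w (toℕ b) <? c) (allFin L))

module _ (w : ℕ → ℕ) (L : ℕ) where

  rank-mono : ∀ {c c′} → c ≤ c′ → rank w L c ≤ rank w L c′
  rank-mono c≤c′ = length-filter-mono (λ b → w (toℕ b) <? _) (λ b → w (toℕ b) <? _)
                     (λ lt → <-≤-trans lt c≤c′) (allFin L)

  rank-cancel-< : ∀ {c c′} → rank w L c < rank w L c′ → c < c′
  rank-cancel-< lt = ≰⇒> (λ c′≤c → <⇒≱ lt (rank-mono c′≤c))

  rank-strict : ∀ {p c} → p < L → w p < c → rank w L (w p) < rank w L c
  rank-strict {p} {c} p<L wp<c =
    length-filter-strict (λ b → w (toℕ b) <? w p) (λ b → w (toℕ b) <? c) (λ lt → <-trans lt wp<c)
      (∈-allFin (fromℕ< p<L)) (subst (λ x → w x < c) (sym p≡) wp<c) (λ lt → <-irrefl (cong w p≡) lt)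
    where
    p≡ : toℕ (fromℕ< p<L) ≡ p
    p≡ = toℕ-fromℕ< p<L

  rank-injective : (∀ {p q} → p < L → q < L → w p ≡ w q → p ≡ q) →
                   ∀ {p q} → p < L → q < L → rank w L (w p) ≡ rank w L (w q) → p ≡ q
  rank-injective w-inj {p} {q} p<L q<L eq with <-cmp (w p) (w q)
  ... | tri< wp<wq _ _ = contradiction eq (<⇒≢ (rank-strict p<L wp<wq))
  ... | tri≈ _ wp≡wq _ = w-inj p<L q<L wp≡wq
  ... | tri> _ _ wq<wp = contradiction (sym eq) (<⇒≢ (rank-strict q<L wq<wp))

  rank-permute : (ρ : Permutation′ L) → ∀ c → rank w L c ≡ length (filter (λ x → w (at ρ (toℕ x)) <? c) (allFin L))
  rank-permute ρ c = trans (sym (length-filter-permute (λ b → w (toℕ b) <? c) ρ))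
    (length-filter-⇔ _ _ (λ x → mk⇔ (subst (λ y → w y < c) (sym (at-toℕ ρ x))) (subst (λ y → w y < c) (at-toℕ ρ x)))
      (allFin L))

  rank-order : (τ : Permutation′ L) → (∀ a → rank w L (w (toℕ a)) ≡ toℕ (τ ⟨$⟩ʳ a)) →
               ∀ {p q} → p < L → q < L → (w p < w q) ⇔ (at τ p < at τ q)
  rank-order τ ranks p<L q<L =
    mk⇔ (λ lt → subst₂ _<_ (rank≡at p<L) (rank≡at q<L) (rank-strict p<L lt))
        (λ lt → rank-cancel-< (subst₂ _<_ (sym (rank≡at p<L)) (sym (rank≡at q<L)) lt))
    where
    rank≡at : ∀ {p} → p < L → rank w L (w p) ≡ at τ p
    rank≡at {p} p<L = begin
      rank w L (w p)                        ≡⟨ cong (rank w L ∘ w) (toℕ-fromℕ< p<L) ⟨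
      rank w L (w (toℕ (fromℕ< p<L)))       ≡⟨ ranks (fromℕ< p<L) ⟩
      toℕ (τ ⟨$⟩ʳ fromℕ< p<L)               ≡⟨ at-fromℕ< τ p<L ⟨
      at τ p                                ∎
      where open ≡-Reasoning

event-order : ∀ {n m} {σ : Permutation′ m} {π : Permutation′ n} {i} → Event σ π i →
              ∀ {p q} → p < m → q < m → (at π (i + p) < at π (i + q)) ⇔ (at σ p < at σ q)
event-order {m = m} {σ} {π} {i} = rank-order (λ p → at π (i + p)) m σ

<⇔≯ : ∀ {x y} → x ≢ y → (x < y) ⇔ (¬ y < x)
<⇔≯ x≢y = mk⇔ <⇒≯ (λ y≮x → ≤∧≢⇒< (≮⇒≥ y≮x) x≢y)

-- Two overlapping occurrences of σ

module DoubleOccurrence {n m : ℕ} (σ : Permutation′ m) {d i : ℕ} (d≤m : d ≤ m) (i+M≤n : i + (m + d) ≤ n) where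

  M : ℕ
  M = m + d

  open WindowShuffle {n} {i} {M} i+M≤n using (shuffle; at-shuffle; shuffle-cancelʳ)

  Occurs : Permutation′ n → Set
  Occurs π = Event σ π i × Event σ π (i + d)

  window : Permutation′ n → ℕ → ℕ
  window π p = at π (i + p)

  window-injective : ∀ π {p q} → p < M → q < M → window π p ≡ window π q → p ≡ q
  window-injective π p<M q<M eq = +-cancelˡ-≡ i _ _ (at-injective π (inWindow p<M) (inWindow q<M) eq)
    where
    inWindow : ∀ {p} → p < M → i + p < n
    inWindow p<M = <-≤-trans (+-monoʳ-< i p<M) i+M≤n

  lastBelow : Permutation′ n → ℕ → ℕ
  lastBelow π c = rank (λ t → window π (m + t)) d c

  firstRank : Permutation′ n → ℕ → ℕ
  firstRank π c = rank (window π) d c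

  -- profile π s is the number of entries of the first block [0, d) exceeding at most s entries of
  -- the last block [m, M): a monotone map recording how the two blocks interleave.
  profile : Permutation′ n → ℕ → ℕ
  profile π s = length (filter (λ a → lastBelow π (window π (toℕ a)) ≤? s) (allFin d))

  profile-mono : ∀ π → Monotone (profile π)
  profile-mono π s = length-filter-mono (λ a → _ ≤? s) (λ a → _ ≤? suc s) m≤n⇒m≤1+n (allFin d)

  profile-≤ : ∀ π s → profile π s ≤ d
  profile-≤ π s = ≤-trans (length-filter (λ a → _ ≤? s) (allFin d)) (≤-reflexive (length-tabulate id))

  module _ (π : Permutation′ n) where

    private
      w : ℕ → ℕ
      w = window π
      w-last : ℕ → ℕ
      w-last t = w (m + t)

    lastBelow-strict : ∀ {t c} → t < d → w (m + t) < c → lastBelow π (w (m + t)) < lastBelow π c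
    lastBelow-strict = rank-strict w-last d

    lastBelow-< : ∀ {t} → t < d → lastBelow π (w (m + t)) < d
    lastBelow-< {t} t<d = <-≤-trans
      (filter-notAll (λ t′ → w (m + toℕ t′) <? w (m + t)) (allFin d)
        (lose (∈-allFin (fromℕ< t<d)) (<-irrefl (cong (λ x → w (m + x)) (toℕ-fromℕ< t<d)))))
      (≤-reflexive (length-tabulate id))

    firstRank<profile⇔ : ∀ {a s} → a < d → (firstRank π (w a) < profile π s) ⇔ (lastBelow π (w a) ≤ s)
    firstRank<profile⇔ {a} {s} a<d = mk⇔ to from
      where
      a≡ : toℕ (fromℕ< a<d) ≡ a
      a≡ = toℕ-fromℕ< a<d
      to : firstRank π (w a) < profile π s → lastBelow π (w a) ≤ s
      to lt with lastBelow π (w a) ≤? s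
      ... | yes le = le
      ... | no  gt = contradiction lt (≤⇒≯ (length-filter-mono (λ b → lastBelow π (w (toℕ b)) ≤? s)
                                                               (λ b → w (toℕ b) <? w a) below (allFin d)))
        where
        below : ∀ {b} → lastBelow π (w (toℕ b)) ≤ s → w (toℕ b) < w a
        below {b} le with w (toℕ b) <? w a
        ... | yes lt′ = lt′
        ... | no  ge  = contradiction (≤-trans (rank-mono w-last d (≮⇒≥ ge)) le) gt
      from : lastBelow π (w a) ≤ s → firstRank π (w a) < profile π s
      from le = length-filter-strict (λ b → w (toℕ b) <? w a) (λ b → lastBelow π (w (toℕ b)) ≤? s)
                  (λ lt → ≤-trans (rank-mono w-last d (<⇒≤ lt)) le) (∈-allFin (fromℕ< a<d))
                  (subst (λ x → lastBelow π (w x) ≤ s) (sym a≡) le) (<-irrefl (cong w a≡))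

    crossing : ∀ {a t} → a < d → t < d →
               (w (m + t) < w a) ⇔ (¬ firstRank π (w a) < profile π (lastBelow π (w (m + t))))
    crossing a<d t<d = mk⇔
      (λ lt X → <⇒≱ (lastBelow-strict t<d lt) (Equivalence.to (firstRank<profile⇔ a<d) X))
      (λ ¬X → rank-cancel-< w-last d (≰⇒> (¬X ∘ Equivalence.from (firstRank<profile⇔ a<d))))

  data Position : ℕ → Set where
    early : ∀ {p} → p < m → Position p
    late  : ∀ {t} → t < d → Position (m + t)

  position : ∀ {p} → p < M → Position p
  position {p} p<M with p <? m
  ... | yes p<m = early p<m
  ... | no  p≮m = subst Position (m+[n∸m]≡n (≮⇒≥ p≮m))
                    (late (subst (p ∸ m <_) (m+n∸m≡n m d) (∸-monoˡ-< p<M (≮⇒≥ p≮m))))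

  first-window-order : ∀ {π} → Occurs π → ∀ {p q} → p < m → q < m →
                       (window π p < window π q) ⇔ (at σ p < at σ q)
  first-window-order {π} (ev , _) = event-order {σ = σ} {π} {i} ev

  second-window-order : ∀ {π} → Occurs π → ∀ {p q} → d ≤ p → p < M → d ≤ q → q < M →
                        (window π p < window π q) ⇔ (at σ (p ∸ d) < at σ (q ∸ d))
  second-window-order {π} (_ , ev) {p} {q} d≤p p<M d≤q q<M =
    subst₂ (λ x y → (at π x < at π y) ⇔ (at σ (p ∸ d) < at σ (q ∸ d))) (shift d≤p) (shift d≤q)
      (event-order {σ = σ} {π} {i + d} ev (back d≤p p<M) (back d≤q q<M))
    where
    shift : ∀ {p} → d ≤ p → i + d + (p ∸ d) ≡ i + p
    shift {p} d≤p = trans (+-assoc i d (p ∸ d)) (cong (i +_) (m+[n∸m]≡n d≤p))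
    back : ∀ {p} → d ≤ p → p < M → p ∸ d < m
    back {p} d≤p p<M = subst (p ∸ d <_) (m+n∸n≡m m d) (∸-monoˡ-< p<M d≤p)

  late-≥d : ∀ t → d ≤ m + t
  late-≥d t = ≤-trans d≤m (m≤m+n m t)

  late-<M : ∀ {t} → t < d → m + t < M
  late-<M = +-monoʳ-< m

  SameProfile : Permutation′ n → Permutation′ n → Set
  SameProfile π π′ = ∀ {s} → s < d → profile π s ≡ profile π′ s

  module _ {π π′ : Permutation′ n} (occ : Occurs π) (occ′ : Occurs π′) where

    first-window-agree : ∀ {p q} → p < m → q < m → (window π p < window π q) ⇔ (window π′ p < window π′ q)
    first-window-agree p<m q<m =
      ⇔-sym (first-window-order occ′ p<m q<m) ⇔-∘ first-window-order occ p<m q<m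

    second-window-agree : ∀ {p q} → d ≤ p → p < M → d ≤ q → q < M →
                          (window π p < window π q) ⇔ (window π′ p < window π′ q)
    second-window-agree d≤p p<M d≤q q<M =
      ⇔-sym (second-window-order occ′ d≤p p<M d≤q q<M) ⇔-∘ second-window-order occ d≤p p<M d≤q q<M

    firstRank-agree : ∀ {a} → a < d → firstRank π (window π a) ≡ firstRank π′ (window π′ a)
    firstRank-agree a<d =
      length-filter-⇔ _ _ (λ b → first-window-agree (<-≤-trans (toℕ<n b) d≤m) (<-≤-trans a<d d≤m)) (allFin d)

    lastBelow-agree : ∀ {t} → t < d → lastBelow π (window π (m + t)) ≡ lastBelow π′ (window π′ (m + t))
    lastBelow-agree t<d = length-filter-⇔ _ _
      (λ t′ → second-window-agree (late-≥d _) (late-<M (toℕ<n t′)) (late-≥d _) (late-<M t<d)) (allFin d)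

    crossing-agree : SameProfile π π′ → ∀ {a t} → a < d → t < d →
                     (window π (m + t) < window π a) ⇔ (window π′ (m + t) < window π′ a)
    crossing-agree same {a} {t} a<d t<d = ⇔-sym (crossing π′ a<d t<d) ⇔-∘ (¬-cong-⇔ X⇔X′ ⇔-∘ crossing π a<d t<d)
      where
      X⇔X′ : (firstRank π (window π a) < profile π (lastBelow π (window π (m + t))))
           ⇔ (firstRank π′ (window π′ a) < profile π′ (lastBelow π′ (window π′ (m + t))))
      X⇔X′ = mk⇔ (subst₂ _<_ r≡ p≡) (subst₂ _<_ (sym r≡) (sym p≡))
        where
        r≡ = firstRank-agree a<d
        p≡ = trans (same (lastBelow-< π t<d)) (cong (profile π′) (lastBelow-agree t<d))

    window-order-agree : SameProfile π π′ → ∀ {p q} → p < M → q < M →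
                         (window π p < window π q) ⇔ (window π′ p < window π′ q)
    window-order-agree same p<M q<M with position p<M | position q<M
    ... | early p<m | early q<m = first-window-agree p<m q<m
    ... | late  t<d | late u<d  = second-window-agree (late-≥d _) p<M (late-≥d _) q<M
    ... | late  t<d | early {q} q<m with d ≤? q
    ...   | yes d≤q = second-window-agree (late-≥d _) p<M d≤q q<M
    ...   | no  d≰q = crossing-agree same (≰⇒> d≰q) t<d
    window-order-agree same p<M q<M
        | early {p} p<m | late {t} t<d with d ≤? p
    ...   | yes d≤p = second-window-agree d≤p p<M (late-≥d _) q<M
    ...   | no  d≰p =
      ⇔-sym (<⇔≯ (distinct π′)) ⇔-∘ (¬-cong-⇔ (crossing-agree same (≰⇒> d≰p) t<d) ⇔-∘ <⇔≯ (distinct π))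
      where
      distinct : ∀ π″ → window π″ p ≢ window π″ (m + t)
      distinct π″ eq = <⇒≢ (<-≤-trans p<m (m≤m+n m t)) (window-injective π″ p<M q<M eq)

  shuffle-injective : ∀ {π π′ ρ ρ′} → Occurs π → Occurs π′ → SameProfile π π′ →
                      shuffle π ρ ≈ shuffle π′ ρ′ → π ≈ π′ × ρ ≈ ρ′
  shuffle-injective {π} {π′} {ρ} {ρ′} occ occ′ same eq = shuffle-cancelʳ {π} {π′} {ρ} {ρ′} ρ≈ρ′ eq , ρ≈ρ′
    where
    shuffled : ∀ {y} → y < M → window π (at ρ y) ≡ window π′ (at ρ′ y)
    shuffled y<M = trans (sym (at-shuffle π ρ y<M))
                     (trans (at-cong eq (<-≤-trans (+-monoʳ-< i y<M) i+M≤n)) (at-shuffle π′ ρ′ y<M))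
    -- ρ y and ρ′ y carry the same value of the shuffled window, hence have the same rank in the
    -- windows of π and π′, whose orders agree.
    ρ≈ρ′ : ρ ≈ ρ′
    ρ≈ρ′ = at-≗⇒≈ λ {y} y<M →
      let a = at ρ y
          b = at ρ′ y
      in rank-injective (window π) M (window-injective π) (at-< ρ y<M) (at-< ρ′ y<M) (begin
        rank (window π) M (window π a)
          ≡⟨ rank-permute (window π) M ρ _ ⟩
        length (filter (λ x → window π (at ρ (toℕ x)) <? window π a) (allFin M))
          ≡⟨ length-filter-⇔ _ _ (λ x → mk⇔ (subst₂ _<_ (shuffled (toℕ<n x)) (shuffled y<M))
                                             (subst₂ _<_ (sym (shuffled (toℕ<n x))) (sym (shuffled y<M)))) (allFin M) ⟩
        length (filter (λ x → window π′ (at ρ′ (toℕ x)) <? window π′ b) (allFin M))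
          ≡⟨ rank-permute (window π′) M ρ′ _ ⟨
        rank (window π′) M (window π′ b)
          ≡⟨ length-filter-⇔ _ _ (λ x → ⇔-sym (window-order-agree occ occ′ same (toℕ<n x) (at-< ρ′ y<M))) (allFin M) ⟩
        rank (window π) M (window π b)
          ∎)
      where open ≡-Reasoning

  occurrences-bound : (L : List (Permutation′ n)) → Distinct L → All Occurs L → length L * M ! ≤ n ! * paths d d
  occurrences-bound L distinct occurs = injective⇒≤ code-injective
    where
    member : Fin (length L * M !) → Permutation′ n
    member x = lookup L (proj₁ (remQuot {length L} (M !) x))
    relabelling : Fin (length L * M !) → Permutation′ M
    relabelling x = decode M (proj₂ (remQuot {length L} (M !) x))
    code : Fin (length L * M !) → Fin (n ! * paths d d)
    code x = combine (encode n (shuffle (member x) (relabelling x))) (encodeMonotone d d (profile (member x)))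
    code-injective : ∀ {x y} → code x ≡ code y → x ≡ y
    code-injective {x} {y} eq with combine-injective _ _ _ _ eq
    ... | shuffle≡ , profile≡ = remQuot-injective {length L} (M !) (cong₂ _,_ member≡ relabelling≡)
      where
      occurs-at : ∀ j → Occurs (lookup L j)
      occurs-at j = All.lookup occurs (∈-lookup {xs = L} j)
      same : SameProfile (member x) (member y)
      same = encodeMonotone-injective d d (profile-mono _) (profile-mono _) (profile-≤ _) (profile-≤ _) profile≡
      recovered = shuffle-injective (occurs-at _) (occurs-at _) same (encode-injective n shuffle≡)
      member≡ = lookup-injective (λ π≈π′ x → sym (π≈π′ x)) distinct _ _ (proj₁ recovered)
      relabelling≡ = decode-injective M {proj₂ (remQuot {length L} (M !) x)} (proj₂ recovered)

windows-fit : ∀ {n m d i} → 0 < d → i + d ≤ n ∸ m → i + (m + d) ≤ n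
windows-fit {n} {m} {d} {i} 0<d i+d≤n∸m with m ≤? n
... | yes m≤n = begin
  i + (m + d)  ≡⟨ regroup i m d ⟩
  i + d + m    ≤⟨ +-monoˡ-≤ m i+d≤n∸m ⟩
  n ∸ m + m    ≡⟨ m∸n+n≡m m≤n ⟩
  n            ∎
  where
  open ≤-Reasoning
  regroup : ∀ i m d → i + (m + d) ≡ i + d + m
  regroup = solve-∀
... | no m≰n = contradiction (≤-trans (m≤n+m d i) (≤-trans i+d≤n∸m (≤-reflexive (m≤n⇒m∸n≡0 (<⇒≤ (≰⇒> m≰n))))))
                             (<⇒≱ 0<d)

-- The hypothesis 1 ≤ k is unused: the counting argument works equally for adjacent windows (k = 0).
lemma4 : ∀ (n m : ℕ) (σ : Permutation′ m) (k i : ℕ) →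
         1 ≤ k → k < m → i + (m ∸ k) ≤ n ∸ m →
         (L : List (Permutation′ n)) → Distinct L →
         All (λ π → Event σ π i × Event σ π (i + (m ∸ k))) L →
         (N : ℕ) →
         length L * length L * (2 * wallisNum N) * (m ∸ k) * ((m + (m ∸ k)) ! * (m + (m ∸ k)) !)
           ≤ 16 ^ (m ∸ k) * (n ! * n !) * wallisDen N
lemma4 n m σ k i _ k<m i+d≤n∸m L distinct occurs N = begin
  ℓ * ℓ * (2 * w) * d * (F * F)          ≡⟨ regroupˡ ℓ w d F ⟩
  (ℓ * F) * (ℓ * F) * (2 * w * d)        ≤⟨ *-monoˡ-≤ (2 * w * d) (*-mono-≤ count count) ⟩
  (n ! * Q) * (n ! * Q) * (2 * w * d)    ≡⟨ regroupᵐ (n !) Q w d ⟩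
  (n ! * n !) * (Q * Q * (2 * w) * d)    ≤⟨ *-monoʳ-≤ (n ! * n !) (central-binomial-bound d N) ⟩
  (n ! * n !) * (16 ^ d * wallisDen N)   ≡⟨ regroupʳ (n ! * n !) (16 ^ d) (wallisDen N) ⟩
  16 ^ d * (n ! * n !) * wallisDen N     ∎
  where
  open ≤-Reasoning
  d = m ∸ k
  ℓ = length L
  w = wallisNum N
  F = (m + d) !
  Q = paths d d
  count : ℓ * F ≤ n ! * Q
  count = DoubleOccurrence.occurrences-bound σ (m∸n≤m m k) (windows-fit (m<n⇒0<n∸m k<m) i+d≤n∸m) L distinct occurs
  regroupˡ : ∀ l w d f → l * l * (2 * w) * d * (f * f) ≡ (l * f) * (l * f) * (2 * w * d)
  regroupˡ = solve-∀
  regroupᵐ : ∀ a q w d → (a * q) * (a * q) * (2 * w * d) ≡ (a * a) * (q * q * (2 * w) * d)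
  regroupᵐ = solve-∀
  regroupʳ : ∀ a p v → a * (p * v) ≡ p * a * v
  regroupʳ = solve-∀
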